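{- Let $Q$ be a key with vertices $\{k,k'\}$. If $q_{kk'}=0$, then $Q$ has at most two acyclic orderings of its vertices, with $k\prec k'$ in one and $k'\prec k$ in the other. If $|q_{kk'}|\geq 1$, then $Q$ has a unique acyclic ordering of its vertices.
   Context: A quiver is a finite directed multigraph with no loops and no 2-cycles; $q_{ij}$ is the number of arrows $i\to j$ if positive and minus the number of arrows $j\to i$ otherwise. $Q\setminus V$ denotes the full subquiver on the vertices not in $V$. Abundant: at least two arrows between every pair of distinct vertices; acyclic: no directed cycle. An acyclic ordering of a quiver on $n$ vertices is a total order $v_1\prec\cdots\prec v_n$ of its vertices such that every arrow $v_i\to v_j$ satisfies $v_i\prec v_j$. A key with vertices $\{k,k'\}$ ($k\ne k'$) is a quiver $Q$ such that $Q\setminus\{k\}$ and $Q\setminus\{k'\}$ are abundant acyclic, and for every vertex $i\notin\{k,k'\}$ either ($k\to i$ and $k'\to i$) or ($i\to k$ and $i\to k'$); any number of arrows (including zero) is allowed between $k$ and $k'$. -}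

module Defs where

open import Data.Nat as ℕ using (ℕ)
open import Data.Integer using (ℤ; +_; -_; ∣_∣; _<_)
open import Data.Fin as Fin using (Fin)
open import Data.Product using (Σ; _×_; _,_; proj₁)
open import Data.Sum using (_⊎_)
open import Relation.Nullary using (¬_)
open import Relation.Binary.PropositionalEquality using (_≡_; _≢_)
open import Function.Definitions using (Injective)

-- A quiver (finite directed multigraph without loops and 2-cycles) on a vertex
-- type V, given by its skew-symmetric integer matrix q:
-- q i j = number of arrows i → j if positive, minus the number of arrows j → i otherwise.
record Quiver (V : Set) : Set where
  field
    q    : V → V → ℤ
    skew : ∀ i j → q i j ≡ - q j i
open Quiver public

Arrow : ∀ {V} → Quiver V → V → V → Set
Arrow Q i j = + 0 < q Q i j

_∖_ : ∀ {V} → Quiver V → (R : V → Set) → Quiver (Σ V (λ v → ¬ R v))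
q    (Q ∖ R) (i , _) (j , _) = q Q i j
skew (Q ∖ R) (i , _) (j , _) = skew Q i j

Abundant : ∀ {V} → Quiver V → Set
Abundant {V} Q = ∀ (i j : V) → i ≢ j → 2 ℕ.≤ ∣ q Q i j ∣

data Walk {V : Set} (Q : Quiver V) : V → V → Set where
  step : ∀ {i j} → Arrow Q i j → Walk Q i j
  _∷_  : ∀ {i j l} → Arrow Q i j → Walk Q j l → Walk Q i l

Acyclic : ∀ {V} → Quiver V → Set
Acyclic {V} Q = ∀ (v : V) → ¬ Walk Q v v

record IsKey {n : ℕ} (Q : Quiver (Fin n)) (k k' : Fin n) : Set where
  field
    distinct   : k ≢ k'
    abundant₁  : Abundant (Q ∖ (_≡ k))
    acyclic₁   : Acyclic  (Q ∖ (_≡ k))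
    abundant₂  : Abundant (Q ∖ (_≡ k'))
    acyclic₂   : Acyclic  (Q ∖ (_≡ k'))
    sides      : ∀ i → i ≢ k → i ≢ k' →
                   (Arrow Q k i × Arrow Q k' i) ⊎ (Arrow Q i k × Arrow Q i k')

-- An acyclic ordering: a total order of the n vertices, given by an injective
-- (hence bijective) position map pos : vertices → {0,…,n-1}, such that every
-- arrow i → j has i ≺ j.
record AcyclicOrdering {n : ℕ} (Q : Quiver (Fin n)) : Set where
  field
    pos       : Fin n → Fin n
    pos-inj   : Injective _≡_ _≡_ pos
    respects  : ∀ i j → Arrow Q i j → pos i Fin.< pos j
open AcyclicOrdering public

Precedes : ∀ {n} {Q : Quiver (Fin n)} → AcyclicOrdering Q → Fin n → Fin n → Set
Precedes o i j = pos o i Fin.< pos o j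

SameOrdering : ∀ {n} {Q : Quiver (Fin n)} → AcyclicOrdering Q → AcyclicOrdering Q → Set
SameOrdering o₁ o₂ = ∀ v → pos o₁ v ≡ pos o₂ v

-- Two acyclic orderings of a quiver order every adjacent pair in the same way, and an
-- ordering is determined by the relative order of all pairs of vertices. In a key, any
-- two distinct vertices other than {k, k'} lie together in one of the abundant
-- subquivers, so they are adjacent; hence fixing the order of k and k' fixes the whole
-- ordering. If moreover k and k' are adjacent, the key is a tournament, and it has no
-- directed triangle: a triangle avoiding k or k' is a cycle of an acyclic subquiver, and
-- one through both meets a third vertex whose arrows point the same way to k and to k'.
-- So the arrows form a transitive tournament, ordered by in-degree.

module Submission where

open import Defs
open import Data.Nat using (ℕ; _≤_; _<_; s≤s; z≤n)
import Data.Nat.Properties as ℕ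
open import Data.Integer using (∣_∣; +_; ℤ; -_; -[1+_]; +<+)
import Data.Integer as ℤ
import Data.Integer.Properties as ℤ
open import Data.Fin using (Fin; toℕ; fromℕ<; punchOut) renaming (_<_ to _<ᶠ_)
open import Data.Fin.Properties
  using (_≟_; any?; punchOut-injective; injective⇒≤; toℕ-injective; toℕ<n; toℕ-fromℕ<)
open import Data.Fin.Subset using (Subset; _∈_; _⊂_; ⊤) renaming (∣_∣ to ∣_∣ₛ)
open import Data.Fin.Subset.Properties using (p⊂q⇒∣p∣<∣q∣; ∣⊤∣≡n; ∈⊤)
open import Data.Vec using (tabulate)
open import Data.Vec.Properties using (lookup∘tabulate; lookup⇒[]=; []=⇒lookup)
open import Data.Product using (Σ; _×_; _,_; proj₁; proj₂; swap)
open import Data.Sum as Sum using (_⊎_; inj₁; inj₂)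
open import Data.Empty using (⊥-elim)
open import Relation.Nullary using (¬_; Dec; yes; no; does)
open import Relation.Nullary.Decidable using (_⊎-dec_; dec-true)
open import Relation.Binary.Definitions using (tri<; tri≈; tri>)
open import Relation.Binary.PropositionalEquality
  using (_≡_; _≢_; refl; sym; trans; cong; subst; subst₂)
open import Function.Definitions using (Injective; Surjective)

nonzero⇒positive⊎negative : ∀ (z : ℤ) → 1 ≤ ∣ z ∣ → + 0 ℤ.< z ⊎ + 0 ℤ.< - z
nonzero⇒positive⊎negative (+ ℕ.suc _) _ = inj₁ (+<+ (s≤s z≤n))
nonzero⇒positive⊎negative -[1+ _ ]    _ = inj₂ (+<+ (s≤s z≤n))

module _ {V : Set} (Q : Quiver V) where

  Adjacent : V → V → Set
  Adjacent i j = Arrow Q i j ⊎ Arrow Q j i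

  Triangle : V → V → V → Set
  Triangle a b c = Arrow Q a b × Arrow Q b c × Arrow Q c a

  IsTournament : Set
  IsTournament = ∀ i j → i ≢ j → Adjacent i j

  arrow? : ∀ i j → Dec (Arrow Q i j)
  arrow? i j = + 0 ℤ.<? q Q i j

  adjacent? : ∀ i j → Dec (Adjacent i j)
  adjacent? i j = arrow? i j ⊎-dec arrow? j i

  arrow-asym : ∀ {i j} → Arrow Q i j → ¬ Arrow Q j i
  arrow-asym {i} {j} i→j j→i = ℤ.<-asym (ℤ.neg-mono-< i→j) (subst (+ 0 ℤ.<_) (skew Q j i) j→i)

  arrow-irrefl : ∀ {i} → ¬ Arrow Q i i
  arrow-irrefl i→i = arrow-asym i→i i→i

  nonzero⇒adjacent : ∀ {i j} → 1 ≤ ∣ q Q i j ∣ → Adjacent i j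
  nonzero⇒adjacent {i} {j} h with nonzero⇒positive⊎negative (q Q i j) h
  ... | inj₁ i→j = inj₁ i→j
  ... | inj₂ j→i = inj₂ (subst (+ 0 ℤ.<_) (sym (skew Q j i)) j→i)

  abundant⇒adjacent : ∀ {R : V → Set} → Abundant (Q ∖ R) →
                      ∀ {i j} → ¬ R i → ¬ R j → i ≢ j → Adjacent i j
  abundant⇒adjacent ab ¬Ri ¬Rj i≢j =
    nonzero⇒adjacent (ℕ.≤-trans (s≤s z≤n) (ab (_ , ¬Ri) (_ , ¬Rj) (λ eq → i≢j (cong proj₁ eq))))

  rotate : ∀ {a b c} → Triangle a b c → Triangle b c a
  rotate (ab , bc , ca) = bc , ca , ab

  acyclic⇒no-triangle : ∀ {R : V → Set} → Acyclic (Q ∖ R) →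
                        ∀ {a b c} → ¬ R a → ¬ R b → ¬ R c → ¬ Triangle a b c
  acyclic⇒no-triangle acyclic ¬Ra ¬Rb ¬Rc (ab , bc , ca) =
    acyclic (_ , ¬Ra) (_∷_ {j = _ , ¬Rb} ab (_∷_ {j = _ , ¬Rc} bc (step ca)))

injective⇒surjective : ∀ {n} {f : Fin n → Fin n} → Injective _≡_ _≡_ f → Surjective _≡_ _≡_ f
injective⇒surjective {ℕ.suc _} {f} f-inj y with any? (λ x → f x ≟ y)
... | yes (x , fx≡y) = x , λ { refl → fx≡y }
... | no ∄x = ⊥-elim (ℕ.<-irrefl refl (injective⇒≤ punchOut-y∘f-injective))
  where
  y≢f : ∀ x → y ≢ f x
  y≢f x y≡fx = ∄x (x , sym y≡fx)

  punchOut-y∘f-injective : Injective _≡_ _≡_ (λ x → punchOut (y≢f x))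
  punchOut-y∘f-injective {x} {x'} eq = f-inj (punchOut-injective (y≢f x) (y≢f x') eq)

module _ {n : ℕ} where

  OrderPreserving : (f g : Fin n → Fin n) → Set
  OrderPreserving f g = ∀ i j → f i <ᶠ f j → g i <ᶠ g j

  orderPreserving-reflects : ∀ {f g} → Injective _≡_ _≡_ f →
                             OrderPreserving f g → OrderPreserving g f
  orderPreserving-reflects {f} {g} f-inj mono i j gi<gj with ℕ.<-cmp (toℕ (f i)) (toℕ (f j))
  ... | tri< fi<fj _ _ = fi<fj
  ... | tri≈ _ fi≡fj _ = ⊥-elim (ℕ.<-irrefl (cong (λ x → toℕ (g x)) (f-inj (toℕ-injective fi≡fj))) gi<gj)
  ... | tri> _ _ fj<fi = ⊥-elim (ℕ.<-asym gi<gj (mono j i fj<fi))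

  orderPreserving⇒toℕ-≤ : ∀ {f g} → Injective _≡_ _≡_ f →
                          OrderPreserving f g → ∀ v → toℕ (f v) ≤ toℕ (g v)
  orderPreserving⇒toℕ-≤ {f} {g} f-inj mono v = below _ v refl
    where
    -- f is onto, so the value just below f v is some f u, and then g u < g v.
    below : ∀ m v → toℕ (f v) ≡ m → m ≤ toℕ (g v)
    below ℕ.zero    v _   = z≤n
    below (ℕ.suc m) v fv≡1+m = ℕ.≤-trans (s≤s (below m u fu≡m)) (mono u v fu<fv)
      where
      m<n : m < n
      m<n = ℕ.<-trans (subst (m <_) (sym fv≡1+m) (ℕ.n<1+n m)) (toℕ<n (f v))
      u : Fin n
      u = proj₁ (injective⇒surjective f-inj (fromℕ< m<n))
      fu≡m : toℕ (f u) ≡ m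
      fu≡m = trans (cong toℕ (proj₂ (injective⇒surjective f-inj (fromℕ< m<n)) refl)) (toℕ-fromℕ< m<n)
      fu<fv : f u <ᶠ f v
      fu<fv = subst₂ _<_ (sym fu≡m) (sym fv≡1+m) (ℕ.n<1+n m)

  orderPreserving⇒≗ : ∀ {f g} → Injective _≡_ _≡_ f → Injective _≡_ _≡_ g →
                      OrderPreserving f g → ∀ v → f v ≡ g v
  orderPreserving⇒≗ f-inj g-inj mono v = toℕ-injective (ℕ.≤-antisym
    (orderPreserving⇒toℕ-≤ f-inj mono v)
    (orderPreserving⇒toℕ-≤ g-inj (orderPreserving-reflects f-inj mono) v))

module _ {n : ℕ} {Q : Quiver (Fin n)} where

  sameOrdering-if-preserved : (o₁ o₂ : AcyclicOrdering Q) →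
                              (∀ i j → Precedes o₁ i j → Precedes o₂ i j) → SameOrdering o₁ o₂
  sameOrdering-if-preserved o₁ o₂ = orderPreserving⇒≗ (pos-inj o₁) (pos-inj o₂)

  adjacent-precedes : (o₁ o₂ : AcyclicOrdering Q) →
                      ∀ {i j} → Adjacent Q i j → Precedes o₁ i j → Precedes o₂ i j
  adjacent-precedes o₁ o₂ (inj₁ i→j) _     = respects o₂ _ _ i→j
  adjacent-precedes o₁ o₂ (inj₂ j→i) i≺₁j = ⊥-elim (ℕ.<-asym i≺₁j (respects o₁ _ _ j→i))

  sameOrdering-if-agree-on-nonadjacent :
    (o₁ o₂ : AcyclicOrdering Q) →
    (∀ i j → i ≢ j → ¬ Adjacent Q i j → Precedes o₁ i j → Precedes o₂ i j) → SameOrdering o₁ o₂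
  sameOrdering-if-agree-on-nonadjacent o₁ o₂ agree = sameOrdering-if-preserved o₁ o₂ preserved
    where
    preserved : ∀ i j → Precedes o₁ i j → Precedes o₂ i j
    preserved i j i≺₁j with adjacent? Q i j | i ≟ j
    ... | yes adj   | _        = adjacent-precedes o₁ o₂ adj i≺₁j
    ... | no _      | yes refl = ⊥-elim (ℕ.<-irrefl refl i≺₁j)
    ... | no ¬adj   | no i≢j   = agree i j i≢j ¬adj i≺₁j

  tournament⇒sameOrdering : IsTournament Q → (o₁ o₂ : AcyclicOrdering Q) → SameOrdering o₁ o₂
  tournament⇒sameOrdering tournament o₁ o₂ =
    sameOrdering-if-agree-on-nonadjacent o₁ o₂ (λ i j i≢j ¬adj → ⊥-elim (¬adj (tournament i j i≢j)))

  noTriangle⇒transitive : IsTournament Q → (∀ {a b c} → ¬ Triangle Q a b c) →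
                          ∀ {i j l} → Arrow Q i j → Arrow Q j l → Arrow Q i l
  noTriangle⇒transitive tournament noTriangle {i} {j} {l} i→j j→l with i ≟ l
  ... | yes refl = ⊥-elim (arrow-asym Q i→j j→l)
  ... | no i≢l with tournament i l i≢l
  ...   | inj₁ i→l = i→l
  ...   | inj₂ l→i = ⊥-elim (noTriangle (i→j , j→l , l→i))

  module _ (tournament : IsTournament Q)
           (transitive : ∀ {i j l} → Arrow Q i j → Arrow Q j l → Arrow Q i l) where

    predecessors : Fin n → Subset n
    predecessors v = tabulate (λ u → does (arrow? Q u v))

    ∈-predecessors⁺ : ∀ {u v} → Arrow Q u v → u ∈ predecessors v
    ∈-predecessors⁺ {u} {v} u→v =
      lookup⇒[]= u _ (trans (lookup∘tabulate _ u) (dec-true (arrow? Q u v) u→v))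

    ∈-predecessors⁻ : ∀ {u v} → u ∈ predecessors v → Arrow Q u v
    ∈-predecessors⁻ {u} {v} u∈ with arrow? Q u v | trans (sym ([]=⇒lookup u∈)) (lookup∘tabulate _ u)
    ... | yes u→v | _  = u→v
    ... | no _    | ()

    predecessors-⊂ : ∀ {i j} → Arrow Q i j → predecessors i ⊂ predecessors j
    predecessors-⊂ i→j =
      (λ u∈ → ∈-predecessors⁺ (transitive (∈-predecessors⁻ u∈) i→j)) ,
      _ , ∈-predecessors⁺ i→j , (λ i∈ → arrow-irrefl Q (∈-predecessors⁻ i∈))

    indegree<n : ∀ v → ∣ predecessors v ∣ₛ < n
    indegree<n v = subst (∣ predecessors v ∣ₛ <_) (∣⊤∣≡n n)
      (p⊂q⇒∣p∣<∣q∣ ((λ _ → ∈⊤) , v , ∈⊤ , (λ v∈ → arrow-irrefl Q (∈-predecessors⁻ v∈))))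

    indegree : Fin n → Fin n
    indegree v = fromℕ< (indegree<n v)

    indegree-respects : ∀ i j → Arrow Q i j → indegree i <ᶠ indegree j
    indegree-respects i j i→j =
      subst₂ _<_ (sym (toℕ-fromℕ< (indegree<n i))) (sym (toℕ-fromℕ< (indegree<n j)))
        (p⊂q⇒∣p∣<∣q∣ (predecessors-⊂ i→j))

    indegree-injective : Injective _≡_ _≡_ indegree
    indegree-injective {i} {j} eq with i ≟ j
    ... | yes i≡j = i≡j
    ... | no i≢j with tournament i j i≢j
    ...   | inj₁ i→j = ⊥-elim (ℕ.<-irrefl (cong toℕ eq) (indegree-respects i j i→j))
    ...   | inj₂ j→i = ⊥-elim (ℕ.<-irrefl (cong toℕ (sym eq)) (indegree-respects j i j→i))

    indegreeOrdering : AcyclicOrdering Q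
    indegreeOrdering = record
      { pos = indegree ; pos-inj = indegree-injective ; respects = indegree-respects }

IsKey-sym : ∀ {n} {Q : Quiver (Fin n)} {k k'} → IsKey Q k k' → IsKey Q k' k
IsKey-sym K = record
  { distinct  = λ k'≡k → distinct (sym k'≡k)
  ; abundant₁ = abundant₂
  ; acyclic₁  = acyclic₂
  ; abundant₂ = abundant₁
  ; acyclic₂  = acyclic₁
  ; sides     = λ i i≢k' i≢k → Sum.map swap swap (sides i i≢k i≢k')
  }
  where open IsKey K

key-noDetour : ∀ {n} {Q : Quiver (Fin n)} {k k'} → IsKey Q k k' →
               ∀ {z} → z ≢ k → z ≢ k' → Arrow Q k z → ¬ Arrow Q z k'
key-noDetour {Q = Q} K z≢k z≢k' k→z z→k' with IsKey.sides K _ z≢k z≢k'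
... | inj₁ (_ , k'→z) = arrow-asym Q k'→z z→k'
... | inj₂ (z→k , _)  = arrow-asym Q k→z z→k

module _ {n : ℕ} {Q : Quiver (Fin n)} {k k' : Fin n} (K : IsKey Q k k') where
  open IsKey K

  key-nonadjacent : ∀ {i j} → i ≢ j → ¬ Adjacent Q i j → (i ≡ k × j ≡ k') ⊎ (i ≡ k' × j ≡ k)
  key-nonadjacent {i} {j} i≢j ¬adj with i ≟ k | j ≟ k
  ... | no i≢k | no j≢k = ⊥-elim (¬adj (abundant⇒adjacent Q abundant₁ i≢k j≢k i≢j))
  ... | yes refl | _ with j ≟ k'
  ...   | yes refl = inj₁ (refl , refl)
  ...   | no j≢k'  = ⊥-elim (¬adj (abundant⇒adjacent Q abundant₂ distinct j≢k' i≢j))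
  key-nonadjacent {i} {j} i≢j ¬adj | no _ | yes refl with i ≟ k'
  ...   | yes refl = inj₂ (refl , refl)
  ...   | no i≢k'  = ⊥-elim (¬adj (abundant⇒adjacent Q abundant₂ i≢k' distinct i≢j))

  key-sameOrdering : (o₁ o₂ : AcyclicOrdering Q) →
                     Precedes o₁ k k' → Precedes o₂ k k' → SameOrdering o₁ o₂
  key-sameOrdering o₁ o₂ k≺₁k' k≺₂k' = sameOrdering-if-agree-on-nonadjacent o₁ o₂ agree
    where
    agree : ∀ i j → i ≢ j → ¬ Adjacent Q i j → Precedes o₁ i j → Precedes o₂ i j
    agree i j i≢j ¬adj i≺₁j with key-nonadjacent i≢j ¬adj
    ... | inj₁ (refl , refl) = k≺₂k'
    ... | inj₂ (refl , refl) = ⊥-elim (ℕ.<-asym k≺₁k' i≺₁j)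

  key-tournament : 1 ≤ ∣ q Q k k' ∣ → IsTournament Q
  key-tournament kk'≢0 i j i≢j with adjacent? Q i j
  ... | yes adj = adj
  ... | no ¬adj with key-nonadjacent i≢j ¬adj
  ...   | inj₁ (refl , refl) = nonzero⇒adjacent Q kk'≢0
  ...   | inj₂ (refl , refl) = Sum.swap (nonzero⇒adjacent Q kk'≢0)

  key-no-triangle-at-k : ∀ {b c} → ¬ Triangle Q k b c
  key-no-triangle-at-k {b} {c} t@(k→b , b→c , c→k) with b ≟ k' | c ≟ k'
  ... | yes refl | _        = key-noDetour (IsKey-sym K) c≢k' c≢k b→c c→k
    where
    c≢k : c ≢ k
    c≢k refl = arrow-irrefl Q c→k
    c≢k' : c ≢ k'
    c≢k' refl = arrow-irrefl Q b→c
  ... | no _     | yes refl = key-noDetour K b≢k b≢k' k→b b→c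
    where
    b≢k : b ≢ k
    b≢k refl = arrow-irrefl Q k→b
    b≢k' : b ≢ k'
    b≢k' refl = arrow-irrefl Q b→c
  ... | no b≢k'  | no c≢k'  = acyclic⇒no-triangle Q acyclic₂ distinct b≢k' c≢k' t

  key-no-triangle : ∀ {a b c} → ¬ Triangle Q a b c
  key-no-triangle {a} {b} {c} t with a ≟ k | b ≟ k | c ≟ k
  ... | yes refl | _        | _        = key-no-triangle-at-k t
  ... | _        | yes refl | _        = key-no-triangle-at-k (rotate Q t)
  ... | _        | _        | yes refl = key-no-triangle-at-k (rotate Q (rotate Q t))
  ... | no a≢k   | no b≢k   | no c≢k   = acyclic⇒no-triangle Q acyclic₁ a≢k b≢k c≢k t

lemma4p3 : ∀ {n : ℕ} (Q : Quiver (Fin n)) (k k' : Fin n) → IsKey Q k k' →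
      (q Q k k' ≡ + 0 →
        (∀ (o₁ o₂ : AcyclicOrdering Q) → Precedes o₁ k k' → Precedes o₂ k k' → SameOrdering o₁ o₂)
        × (∀ (o₁ o₂ : AcyclicOrdering Q) → Precedes o₁ k' k → Precedes o₂ k' k → SameOrdering o₁ o₂))
      × (1 ≤ ∣ q Q k k' ∣ →
        Σ (AcyclicOrdering Q) (λ o → ∀ (o' : AcyclicOrdering Q) → SameOrdering o o'))
lemma4p3 Q k k' K = (λ _ → key-sameOrdering K , key-sameOrdering (IsKey-sym K)) , unique
  where
  unique : 1 ≤ ∣ q Q k k' ∣ → Σ (AcyclicOrdering Q) (λ o → ∀ o' → SameOrdering o o')
  unique kk'≢0 = o , tournament⇒sameOrdering tournament o
    where
    tournament : IsTournament Q
    tournament = key-tournament K kk'≢0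
    o : AcyclicOrdering Q
    o = indegreeOrdering tournament (noTriangle⇒transitive {Q = Q} tournament (key-no-triangle K))
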